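{- Let $\overrightarrow{G}=(V,E,w)$ be a directed graph with nonnegative edge weights, let $H$ be its semi-double cover, and let $k\in\mathbb{N}$. Then $$\bar{\rho}_{\overrightarrow{G}}(k)=1-\min_{C_1,\dots,C_k}\max_{1\le i\le k}\phi_H(C_i),$$ where the minimum is over all $k$-tuples of disjoint simple subsets of $V_H$ of the form $C_i=(A_i)_1\cup(B_i)_2$, $1\le i\le k$, with $(A_1,B_1),\dots,(A_k,B_k)$ ranging over the same family of pairs of subsets of $V$ as in the definition of $\bar{\rho}_{\overrightarrow{G}}(k)$.
   Context: For a directed weighted graph $\overrightarrow{G}=(V,E,w)$ and $u\in V$, $\deg_{\mathrm{out}}(u)=\sum_{(u,v)\in E}w(u,v)$, $\deg_{\mathrm{in}}(u)=\sum_{(v,u)\in E}w(v,u)$; $\mathrm{vol}_{\mathrm{out}}(S)=\sum_{u\in S}\deg_{\mathrm{out}}(u)$, $\mathrm{vol}_{\mathrm{in}}(S)=\sum_{u\in S}\deg_{\mathrm{in}}(u)$. For disjoint $A,B\subseteq V$, $w_{\overrightarrow{G}}(A,B)=\sum_{(u,v)\in E,\,u\in A,\,v\in B}w(u,v)$ and $\overline{\phi}_{\overrightarrow{G}}(A,B)=\frac{2w_{\overrightarrow{G}}(A,B)}{\mathrm{vol}_{\mathrm{out}}(A)+\mathrm{vol}_{\mathrm{in}}(B)}$. The $k$-way directed dual Cheeger constant is $\bar{\rho}_{\overrightarrow{G}}(k)=\max\min_{1\le i\le k}\overline{\phi}_{\overrightarrow{G}}(A_i,B_i)$, the maximum over all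 $k$ pairs $(A_1,B_1),\dots,(A_k,B_k)$ of subsets of $V$ with $A_i\cap B_i=\emptyset$, $A_i\cup B_i\neq\emptyset$ for all $i$, and $A_i\cap A_j=B_i\cap B_j=A_i\cap B_j=\emptyset$ for $i\neq j$. The semi-double cover of $\overrightarrow{G}$ is the undirected weighted graph $H=(V_H,E_H,w_H)$ with $V_H=\{v_1,v_2: v\in V\}$ (two copies of each vertex) and, for each directed edge $(u,v)\in E$, an undirected edge $\{u_1,v_2\}\in E_H$ of weight $w(u,v)$. For $S\subseteq V$, $S_1=\{v_1: v\in S\}$ and $S_2=\{v_2:v\in S\}$. A set $S\subseteq V_H$ is simple if $|\{v_1,v_2\}\cap S|\le 1$ for all $v\in V$. For $S\subseteq V_H$, $\phi_H(S)=\frac{w_H(S,V_H\setminus S)}{\mathrm{vol}_H(S)}$, where $\mathrm{vol}_H(S)$ is the sum of weighted degrees in $H$ of vertices of $S$ and $w_H(S,T)$ is the total weight of edges of $H$ between $S$ and $T$.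
   Formalization: The edge weights of the directed graph are nonnegative rationals. -}

module Defs where

open import Data.Bool using (Bool; true; false; if_then_else_; _∧_; not)
open import Data.Nat as ℕ using (ℕ; zero; suc)
open import Data.Fin using (Fin; zero; suc)
open import Data.Fin.Subset using (Subset; _∈_)
open import Data.Vec using (lookup)
open import Data.Rational using (ℚ; 0ℚ; 1ℚ; _+_; _-_; _*_; _÷_; _⊓_; _⊔_; _≤_; _<_; ≢-nonZero)
open import Data.Rational.Properties using (_≟_)
open import Data.Sum using (_⊎_; inj₁; inj₂)
open import Data.Product using (_×_; _,_; proj₁; proj₂; ∃)
open import Relation.Nullary using (¬_; yes; no)
open import Relation.Binary.PropositionalEquality using (_≡_; _≢_)

sumFin : (n : ℕ) → (Fin n → ℚ) → ℚ
sumFin zero    f = 0ℚ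
sumFin (suc n) f = f zero + sumFin n (λ i → f (suc i))

-- min_{i ∈ Fin k} f i  (only used for k ≥ 1; value at k = 0 is irrelevant)
minFin : (k : ℕ) → (Fin k → ℚ) → ℚ
minFin zero          f = 0ℚ
minFin (suc zero)    f = f zero
minFin (suc (suc k)) f = f zero ⊓ minFin (suc k) (λ i → f (suc i))

-- max_{i ∈ Fin k} f i  (only used for k ≥ 1)
maxFin : (k : ℕ) → (Fin k → ℚ) → ℚ
maxFin zero          f = 0ℚ
maxFin (suc zero)    f = f zero
maxFin (suc (suc k)) f = f zero ⊔ maxFin (suc k) (λ i → f (suc i))

-- total division; only ever applied with a positive denominator below
_/'_ : ℚ → ℚ → ℚ
p /' q with q ≟ 0ℚ
... | yes _  = 0ℚ
... | no q≢0 = _÷_ p q {{≢-nonZero q≢0}}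

[_]·_ : Bool → ℚ → ℚ
[ true  ]· x = x
[ false ]· x = 0ℚ

-- Directed weighted graphs on vertex set V = Fin n.
-- w u v is the weight of the directed edge (u,v); w u v = 0 means no edge.

record DiGraph (n : ℕ) : Set where
  field
    w     : Fin n → Fin n → ℚ
    w-nonneg : ∀ u v → 0ℚ ≤ w u v
open DiGraph public

module _ {n : ℕ} (G : DiGraph n) where

  degOut : Fin n → ℚ
  degOut u = sumFin n (λ v → w G u v)

  degIn : Fin n → ℚ
  degIn u = sumFin n (λ v → w G v u)

  volOut : Subset n → ℚ
  volOut S = sumFin n (λ u → [ lookup S u ]· degOut u)

  volIn : Subset n → ℚ
  volIn S = sumFin n (λ u → [ lookup S u ]· degIn u)

  wAB : Subset n → Subset n → ℚ
  wAB A B = sumFin n (λ u → sumFin n (λ v → [ lookup A u ∧ lookup B v ]· w G u v))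

  denG : Subset n → Subset n → ℚ
  denG A B = volOut A + volIn B

  φbar : Subset n → Subset n → ℚ
  φbar A B = ((1ℚ + 1ℚ) * wAB A B) /' denG A B

-- V_H = Fin n ⊎ Fin n, where inj₁ v = v₁, inj₂ v = v₂.

VH : ℕ → Set
VH n = Fin n ⊎ Fin n

sumH : (n : ℕ) → (VH n → ℚ) → ℚ
sumH n f = sumFin n (λ v → f (inj₁ v)) + sumFin n (λ v → f (inj₂ v))

SubsetH : ℕ → Set
SubsetH n = VH n → Bool

module _ {n : ℕ} (G : DiGraph n) where

  wH : VH n → VH n → ℚ
  wH (inj₁ u) (inj₂ v) = w G u v
  wH (inj₂ v) (inj₁ u) = w G u v
  wH (inj₁ _) (inj₁ _) = 0ℚ
  wH (inj₂ _) (inj₂ _) = 0ℚ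

  degH : VH n → ℚ
  degH x = sumH n (λ y → wH x y)

  volH : SubsetH n → ℚ
  volH S = sumH n (λ x → [ S x ]· degH x)

  cutH : SubsetH n → ℚ
  cutH S = sumH n (λ x → sumH n (λ y → [ S x ∧ not (S y) ]· wH x y))

  φH : SubsetH n → ℚ
  φH S = cutH S /' volH S

lift : {n : ℕ} → Subset n → Subset n → SubsetH n
lift A B (inj₁ v) = lookup A v
lift A B (inj₂ v) = lookup B v

Pairs : ℕ → ℕ → Set
Pairs n k = Fin k → Subset n × Subset n

module _ {n : ℕ} (G : DiGraph n) where

  Admissible : {k : ℕ} → Pairs n k → Set
  Admissible {k} P =
      (∀ i → ∀ u → ¬ (u ∈ proj₁ (P i) × u ∈ proj₂ (P i)))
    × (∀ i → ∃ λ u → (u ∈ proj₁ (P i)) ⊎ (u ∈ proj₂ (P i)))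
    × (∀ i j → i ≢ j → ∀ u → ¬ (u ∈ proj₁ (P i) × u ∈ proj₁ (P j)))
    × (∀ i j → i ≢ j → ∀ u → ¬ (u ∈ proj₂ (P i) × u ∈ proj₂ (P j)))
    × (∀ i j → i ≢ j → ∀ u → ¬ (u ∈ proj₁ (P i) × u ∈ proj₂ (P j)))
    × (∀ i → 0ℚ < denG G (proj₁ (P i)) (proj₂ (P i)))                 -- ratio is defined

  objG : {k : ℕ} → Pairs n k → ℚ
  objG {k} P = minFin k (λ i → φbar G (proj₁ (P i)) (proj₂ (P i)))

  objH : {k : ℕ} → Pairs n k → ℚ
  objH {k} P = maxFin k (λ i → φH G (lift (proj₁ (P i)) (proj₂ (P i))))

  -- r is the maximum of objG over admissible k-tuples, i.e. r = ρ̄_G(k)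
  IsDualCheeger : (k : ℕ) → ℚ → Set
  IsDualCheeger k r =
      (∃ λ (P : Pairs n k) → Admissible P × objG P ≡ r)
    × (∀ (P : Pairs n k) → Admissible P → objG P ≤ r)

  IsMinMaxH : (k : ℕ) → ℚ → Set
  IsMinMaxH k r =
      (∃ λ (P : Pairs n k) → Admissible P × objH P ≡ r)
    × (∀ (P : Pairs n k) → Admissible P → r ≤ objH P)

{-# OPTIONS --safe #-}
-- For C = A₁ ∪ B₂ every edge of H at C either leaves C or joins A₁ to B₂, and the
-- latter are exactly the edges of G from A to B, each counted once from each end.
-- Hence vol_H(C) = vol_out(A) + vol_in(B) = w_H(C, V_H ∖ C) + 2 w(A, B), i.e.
-- φ_H(C) = 1 − φ̄(A, B) for every admissible pair.  Since x ↦ 1 − x is an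
-- order-reversing involution, it turns the maximum over admissible k-tuples of the
-- minimum of the φ̄ into the minimum of the maximum of the φ_H.
module Submission where

open import Defs
open import Data.Nat using (ℕ; NonZero; zero; suc)
open import Data.Rational
  using (ℚ; 0ℚ; 1ℚ; _+_; _-_; _*_; _÷_; 1/_; _⊓_; _⊔_; _≤_; _≥_; _<_; ≢-nonZero)
open import Function.Bundles using (_⇔_; mk⇔)

open import Data.Bool using (Bool; true; false; _∧_; not)
open import Data.Bool.Properties using (∧-comm)
open import Data.Fin using (Fin; zero; suc)
open import Data.Fin.Subset using (Subset)
open import Data.Product using (_×_; _,_; ∃; proj₁; proj₂)
import Data.Rational.Properties as ℚ
open import Data.Rational.Solver using (module +-*-Solver)
open import Data.Vec using (lookup)
open import Function.Base using (_∘_)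
open import Relation.Binary.Definitions using (Monotonic₁)
open import Relation.Binary.PropositionalEquality
open import Relation.Nullary using (yes; no; contradiction)

open import Algebra.Definitions {A = ℚ} _≡_ using (Involutive)

open import Algebra.Properties.CommutativeMonoid.Sum ℚ.+-0-commutativeMonoid
  using (sum; sum-cong-≗; sum-replicate-zero; ∑-distrib-+; ∑-comm)

open +-*-Solver
open ≡-Reasoning

sumFin≡sum : ∀ n (f : Fin n → ℚ) → sumFin n f ≡ sum f
sumFin≡sum zero    f = refl
sumFin≡sum (suc n) f = cong (f zero +_) (sumFin≡sum n (f ∘ suc))

sumFin-cong : ∀ n {f g : Fin n → ℚ} → f ≗ g → sumFin n f ≡ sumFin n g
sumFin-cong n {f} {g} f≗g = begin
  sumFin n f  ≡⟨ sumFin≡sum n f ⟩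
  sum f       ≡⟨ sum-cong-≗ f≗g ⟩
  sum g       ≡⟨ sumFin≡sum n g ⟨
  sumFin n g  ∎

sumFin-zero : ∀ n → sumFin n (λ _ → 0ℚ) ≡ 0ℚ
sumFin-zero n = trans (sumFin≡sum n _) (sum-replicate-zero n)

sumFin-distrib-+ : ∀ n (f g : Fin n → ℚ) →
                   sumFin n (λ i → f i + g i) ≡ sumFin n f + sumFin n g
sumFin-distrib-+ n f g = begin
  sumFin n (λ i → f i + g i)  ≡⟨ sumFin≡sum n _ ⟩
  sum (λ i → f i + g i)       ≡⟨ ∑-distrib-+ f g ⟩
  sum f + sum g               ≡⟨ cong₂ _+_ (sumFin≡sum n f) (sumFin≡sum n g) ⟨
  sumFin n f + sumFin n g     ∎

sumFin-comm : ∀ m n (f : Fin m → Fin n → ℚ) →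
              sumFin m (λ i → sumFin n (f i)) ≡ sumFin n (λ j → sumFin m (λ i → f i j))
sumFin-comm m n f = begin
  sumFin m (λ i → sumFin n (f i))               ≡⟨ sumFin-cong m (λ i → sumFin≡sum n (f i)) ⟩
  sumFin m (λ i → sum (f i))                    ≡⟨ sumFin≡sum m _ ⟩
  sum (λ i → sum (f i))                         ≡⟨ ∑-comm f ⟩
  sum (λ j → sum (λ i → f i j))                 ≡⟨ sumFin≡sum n _ ⟨
  sumFin n (λ j → sum (λ i → f i j))            ≡⟨ sumFin-cong n (λ j → sumFin≡sum m _) ⟨
  sumFin n (λ j → sumFin m (λ i → f i j))       ∎

[]·-zeroʳ : ∀ p → [ p ]· 0ℚ ≡ 0ℚ
[]·-zeroʳ true  = refl
[]·-zeroʳ false = refl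

[]·-distrib-sumFin : ∀ n p (f : Fin n → ℚ) → [ p ]· sumFin n f ≡ sumFin n (λ i → [ p ]· f i)
[]·-distrib-sumFin n true  f = refl
[]·-distrib-sumFin n false f = sym (sumFin-zero n)

sumFin-[]·0 : ∀ n (p : Fin n → Bool) → sumFin n (λ i → [ p i ]· 0ℚ) ≡ 0ℚ
sumFin-[]·0 n p = trans (sumFin-cong n ([]·-zeroʳ ∘ p)) (sumFin-zero n)

x+[0+0]≡x : ∀ p → p + (0ℚ + 0ℚ) ≡ p
x+[0+0]≡x p = trans (cong (p +_) (ℚ.+-identityˡ 0ℚ)) (ℚ.+-identityʳ p)

[0+0]+x≡x : ∀ p → (0ℚ + 0ℚ) + p ≡ p
[0+0]+x≡x p = trans (cong (_+ p) (ℚ.+-identityˡ 0ℚ)) (ℚ.+-identityˡ p)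

[]·-+-split : ∀ p q x →
  [ p ]· x + [ q ]· x ≡ ([ p ∧ not q ]· x + [ not p ∧ q ]· x) + ([ p ∧ q ]· x + [ p ∧ q ]· x)
[]·-+-split true  true  x = sym ([0+0]+x≡x (x + x))
[]·-+-split true  false x = sym (x+[0+0]≡x (x + 0ℚ))
[]·-+-split false true  x = sym (x+[0+0]≡x (0ℚ + x))
[]·-+-split false false x = refl

ΣΣ : ∀ n → (Fin n → Fin n → ℚ) → ℚ
ΣΣ n f = sumFin n (λ u → sumFin n (f u))

ΣΣ-cong : ∀ n {f g : Fin n → Fin n → ℚ} → (∀ u v → f u v ≡ g u v) → ΣΣ n f ≡ ΣΣ n g
ΣΣ-cong n f≗g = sumFin-cong n (λ u → sumFin-cong n (f≗g u))

ΣΣ-distrib-+ : ∀ n (f g : Fin n → Fin n → ℚ) →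
               ΣΣ n (λ u v → f u v + g u v) ≡ ΣΣ n f + ΣΣ n g
ΣΣ-distrib-+ n f g = trans (sumFin-cong n (λ u → sumFin-distrib-+ n (f u) (g u)))
                           (sumFin-distrib-+ n _ _)

module _ {n : ℕ} (G : DiGraph n) (A B : Subset n) where

  private
    a b : Fin n → Bool
    a = lookup A
    b = lookup B

    crossing intersect : Fin n → Fin n → ℚ
    crossing u v = [ a u ∧ not (b v) ]· w G u v + [ not (a u) ∧ b v ]· w G u v
    intersect u v = [ a u ∧ b v ]· w G u v

  volOut≡ΣΣ : volOut G A ≡ ΣΣ n (λ u v → [ a u ]· w G u v)
  volOut≡ΣΣ = sumFin-cong n (λ u → []·-distrib-sumFin n (a u) (w G u))

  volIn≡ΣΣ : volIn G B ≡ ΣΣ n (λ u v → [ b v ]· w G u v)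
  volIn≡ΣΣ = trans (sumFin-cong n (λ v → []·-distrib-sumFin n (b v) (λ u → w G u v)))
                   (sumFin-comm n n _)

  volH-lift : volH G (lift A B) ≡ denG G A B
  volH-lift = cong₂ _+_
    (sumFin-cong n (λ u → cong ([ a u ]·_) (trans (cong (_+ degOut G u) (sumFin-zero n))
                                                  (ℚ.+-identityˡ _))))
    (sumFin-cong n (λ v → cong ([ b v ]·_) (trans (cong (degIn G v +_) (sumFin-zero n))
                                                  (ℚ.+-identityʳ _))))

  cutH-lift : cutH G (lift A B) ≡ ΣΣ n crossing
  cutH-lift = begin
    cutH G (lift A B)
      ≡⟨ cong₂ _+_
           (sumFin-cong n (λ u → trans
              (cong (_+ leaving₁ u) (sumFin-[]·0 n (λ y → a u ∧ not (a y))))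
              (ℚ.+-identityˡ _)))
           (sumFin-cong n (λ v → trans
              (cong (leaving₂ v +_) (sumFin-[]·0 n (λ y → b v ∧ not (b y))))
              (ℚ.+-identityʳ _))) ⟩
    sumFin n leaving₁ + sumFin n leaving₂
      ≡⟨ cong (sumFin n leaving₁ +_)
              (trans (sumFin-comm n n _)
                     (ΣΣ-cong n (λ v u → cong ([_]· w G u v) (∧-comm (not (a u)) (b v))))) ⟨
    ΣΣ n (λ u v → [ a u ∧ not (b v) ]· w G u v) + ΣΣ n (λ u v → [ not (a u) ∧ b v ]· w G u v)
      ≡⟨ ΣΣ-distrib-+ n _ _ ⟨
    ΣΣ n crossing ∎
    where
    leaving₁ leaving₂ : Fin n → ℚ
    leaving₁ u = sumFin n (λ v → [ a u ∧ not (b v) ]· w G u v)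
    leaving₂ v = sumFin n (λ u → [ b v ∧ not (a u) ]· w G u v)

  cutH-lift+2wAB≡denG : cutH G (lift A B) + (1ℚ + 1ℚ) * wAB G A B ≡ denG G A B
  cutH-lift+2wAB≡denG = begin
    cutH G (lift A B) + (1ℚ + 1ℚ) * W
      ≡⟨ cong₂ _+_ cutH-lift (solve 1 (λ x → (con 1ℚ :+ con 1ℚ) :* x := x :+ x) refl W) ⟩
    ΣΣ n crossing + (W + W)
      ≡⟨ trans (ΣΣ-distrib-+ n crossing _)
               (cong (ΣΣ n crossing +_) (ΣΣ-distrib-+ n intersect intersect)) ⟨
    ΣΣ n (λ u v → crossing u v + (intersect u v + intersect u v))
      ≡⟨ ΣΣ-cong n (λ u v → []·-+-split (a u) (b v) (w G u v)) ⟨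
    ΣΣ n (λ u v → [ a u ]· w G u v + [ b v ]· w G u v)
      ≡⟨ ΣΣ-distrib-+ n _ _ ⟩
    ΣΣ n (λ u v → [ a u ]· w G u v) + ΣΣ n (λ u v → [ b v ]· w G u v)
      ≡⟨ cong₂ _+_ volOut≡ΣΣ volIn≡ΣΣ ⟨
    denG G A B ∎
    where
    W = wAB G A B

/'-≢0 : ∀ p {q} (q≢0 : q ≢ 0ℚ) → p /' q ≡ _÷_ p q {{≢-nonZero q≢0}}
/'-≢0 p {q} q≢0 with q ℚ.≟ 0ℚ
... | yes q≡0 = contradiction q≡0 q≢0
... | no  _   = refl

/'-complement : ∀ {c t d} → d ≢ 0ℚ → c + t ≡ d → c /' d ≡ 1ℚ - t /' d
/'-complement {c} {t} d≢0 refl = begin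
  c /' (c + t)                        ≡⟨ /'-≢0 c d≢0 ⟩
  c * 1/ (c + t)                      ≡⟨ solve 3 (λ c t i → c :* i := (c :+ t) :* i :- t :* i)
                                               refl c t (1/ (c + t)) ⟩
  (c + t) * 1/ (c + t) - t * 1/ (c + t) ≡⟨ cong (_- t * 1/ (c + t)) (ℚ.*-inverseʳ (c + t)) ⟩
  1ℚ - t * 1/ (c + t)                 ≡⟨ cong (1ℚ -_) (/'-≢0 t d≢0) ⟨
  1ℚ - t /' (c + t)                   ∎
  where instance _ = ≢-nonZero d≢0

φH-lift : ∀ {n} (G : DiGraph n) (A B : Subset n) → 0ℚ < denG G A B →
          φH G (lift A B) ≡ 1ℚ - φbar G A B
φH-lift G A B den>0 rewrite volH-lift G A B =
  /'-complement (≢-sym (ℚ.<⇒≢ den>0)) (cutH-lift+2wAB≡denG G A B)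

1-antimono-≤ : Monotonic₁ _≤_ _≥_ (1ℚ -_)
1-antimono-≤ p≤q = ℚ.+-monoʳ-≤ 1ℚ (ℚ.neg-antimono-≤ p≤q)

1-involutive : Involutive (1ℚ -_)
1-involutive = solve 1 (λ x → con 1ℚ :- (con 1ℚ :- x) := x) refl

maxFin-antimono-minFin : ∀ {h} → Monotonic₁ _≤_ _≥_ h → ∀ k .{{_ : NonZero k}} →
                         (f g : Fin k → ℚ) → g ≗ h ∘ f → maxFin k g ≡ h (minFin k f)
maxFin-antimono-minFin h-anti (suc zero)    f g g≗hf = g≗hf zero
maxFin-antimono-minFin {h} h-anti (suc (suc k)) f g g≗hf = begin
  g zero ⊔ maxFin (suc k) (g ∘ suc)
    ≡⟨ cong₂ _⊔_ (g≗hf zero)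
                 (maxFin-antimono-minFin h-anti (suc k) (f ∘ suc) (g ∘ suc) (g≗hf ∘ suc)) ⟩
  h (f zero) ⊔ h (minFin (suc k) (f ∘ suc))
    ≡⟨ ℚ.antimono-≤-distrib-⊓ h-anti (f zero) _ ⟨
  h (f zero ⊓ minFin (suc k) (f ∘ suc)) ∎

module _ {I : Set} (Adm : I → Set) where

  IsMaximum IsMinimum : (I → ℚ) → ℚ → Set
  IsMaximum f r = (∃ λ i → Adm i × f i ≡ r) × (∀ i → Adm i → f i ≤ r)
  IsMinimum f r = (∃ λ i → Adm i × f i ≡ r) × (∀ i → Adm i → r ≤ f i)

  IsMaximum⇔IsMinimum : ∀ {h} → Monotonic₁ _≤_ _≥_ h → Involutive h →
                        ∀ {f g r} → (∀ i → Adm i → g i ≡ h (f i)) →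
                        IsMaximum f r ⇔ IsMinimum g (h r)
  IsMaximum⇔IsMinimum {h} h-anti h-invol {f} {g} {r} g≡hf = mk⇔ to from
    where
    to : IsMaximum f r → IsMinimum g (h r)
    to ((i , adm , fi≡r) , f≤r) =
      (i , adm , trans (g≡hf i adm) (cong h fi≡r)) ,
      λ j adm′ → subst (h r ≤_) (sym (g≡hf j adm′)) (h-anti (f≤r j adm′))
    h-injective : ∀ {x y} → h x ≡ h y → x ≡ y
    h-injective {x} {y} hx≡hy = begin
      x        ≡⟨ h-invol x ⟨
      h (h x)  ≡⟨ cong h hx≡hy ⟩
      h (h y)  ≡⟨ h-invol y ⟩
      y        ∎
    from : IsMinimum g (h r) → IsMaximum f r
    from ((i , adm , gi≡hr) , hr≤g) =
      (i , adm , h-injective (trans (sym (g≡hf i adm)) gi≡hr)) ,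
      λ j adm′ → subst₂ _≤_ (h-invol (f j)) (h-invol r)
                          (h-anti (subst (h r ≤_) (g≡hf j adm′) (hr≤g j adm′)))

objH≡1-objG : ∀ {n} (G : DiGraph n) k .{{_ : NonZero k}} (P : Pairs n k) →
              Admissible G P → objH G P ≡ 1ℚ - objG G P
objH≡1-objG G k P (_ , _ , _ , _ , _ , den>0) =
  maxFin-antimono-minFin 1-antimono-≤ k _ _
    (λ i → φH-lift G (proj₁ (P i)) (proj₂ (P i)) (den>0 i))

lemma4 : (n : ℕ) (G : DiGraph n) (k : ℕ) → .{{_ : NonZero k}} → (r : ℚ) →
    IsDualCheeger G k r ⇔ IsMinMaxH G k (1ℚ - r)
lemma4 n G k r =
  IsMaximum⇔IsMinimum (Admissible G) 1-antimono-≤ 1-involutive (objH≡1-objG G k)
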